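{- Let $q$ be a prime power and let $(k_i)_{i\ge0}$, $(d_i)_{i\ge 0}$ be sequences of positive integers with $q\geq d_0k_0+1$ and, for all $i\geq 0$, $k_i\leq k_{i+1}$, $d_i\leq d_{i+1}$ and $q^{2^{i}}\geq d_{i+1}k_{i+1}+1$. Then, after suitable row and column permutations of each matrix (putting, at each step, the rows and columns of the previous matrix first), the sequence $(\mathbf{C}_{q^{2^{i}},k_i,d_i})_{i\geq 0}$ of permuted matrices $C_{q^{2^i},k_i,d_i}$ is an embedding family of incidence matrices of CFFs, where $C_{q^{2^i},k_i,d_i}$ is a $d_i$-CFF.
   Context: A $d$-CFF$(t,n)$ is a set system $(X,\mathcal{B})$, $|X|=t$, $|\mathcal{B}|=n$, $B\subseteq X$ for $B\in\mathcal B$, such that no member of $\mathcal{B}$ is contained in the union of any $d$ other members; it is represented by its $t\times n$ binary incidence matrix. For a prime power $r$ with the elements of $\mathbb{F}_r$ listed in a fixed order $x_1,\dots,x_r$, and positive integers $\kappa,\delta$ with $r\ge \delta\kappa+1$, the matrix $C_{r,\kappa,\delta}$ has rows indexed by pairs $(x_j,y)$ with $1\le j\le \delta\kappa+1$, $y\in\mathbb{F}_r$, columns indexed by polynomials $f\in\mathbb{F}_r[x]$ of degree at most $\kappa$, and entry $1$ iff $f(x_j)=y$. The fields are nested, $\mathbb{F}_{q^{2^i}}\subseteq\mathbb{F}_{q^{2^{i+1}}}$, and the ordering of $\mathbb{F}_{q^{2^{i+1}}}$ lists the elements of $\mathbb{F}_{q^{2^i}}$ first in the same order. An embedding family is a sequence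 $(\mathcal{M}^{(l)})_l$ of incidence matrices of set systems $(X_l,\mathcal{B}_l)$, where $\mathcal{M}^{(l)}$ is a $d(l)$-CFF, such that $X_l\subseteq X_{l+1}$, the numbers of rows and of columns are nondecreasing in $l$, $d(l)\le d(l+1)$, and $\mathcal{M}^{(l+1)}=\begin{pmatrix}\mathcal{M}^{(l)} & Y\\ Z& W\end{pmatrix}$ for some matrices $Y,Z,W$. -}

module Defs where

open import Data.Nat using (ℕ; zero; suc; _+_; _*_; _^_; _≤_; _<_)
open import Data.Nat.Primality using (Prime)
open import Data.Fin using (Fin; inject≤; _≟_)
open import Data.Vec using (Vec; []; _∷_)
open import Data.Bool using (Bool; true; false)
open import Data.Product using (Σ; ∃; _×_; _,_)
open import Relation.Binary.PropositionalEquality using (_≡_; _≢_)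
open import Relation.Nullary using (does)
open import Function.Bundles using (_↔_; Inverse)
open import Function.Definitions using (Injective)
open import Algebra.Structures using (IsCommutativeRing)

IsPrimePower : ℕ → Set
IsPrimePower q = Σ ℕ λ p → Σ ℕ λ m → Prime p × 1 ≤ m × q ≡ p ^ m

record FieldOn (A : Set) : Set where
  field
    _+F_ _*F_ : A → A → A
    -F_       : A → A
    0F 1F     : A
    isCommutativeRing : IsCommutativeRing _≡_ _+F_ _*F_ -F_ 0F 1F
    0≢1       : 0F ≢ 1F
    _⁻¹       : A → A
    inverse   : ∀ x → x ≢ 0F → x *F (x ⁻¹) ≡ 1F

open FieldOn public

-- A finite field of order r whose elements are listed in the fixed order
-- x_1, ..., x_r; we identify F_r with Fin r via this ordering (x_{j+1} = j).
FiniteField : ℕ → Set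
FiniteField r = FieldOn (Fin r)

-- Polynomials of degree at most κ over F, as coefficient vectors
-- (a_0, a_1, ..., a_κ) representing a_0 + a_1 x + ... + a_κ x^κ.
Poly : ∀ {A : Set} → ℕ → Set
Poly {A} κ = Vec A (suc κ)

eval : ∀ {A : Set} {m} → FieldOn A → Vec A m → A → A
eval F []       a = 0F F
eval F (c ∷ cs) a = _+F_ F c (_*F_ F a (eval F cs a))

-- The matrix C_{r,κ,δ}: rows indexed by pairs (x_j , y), 1 ≤ j ≤ δκ+1
-- (j represented by Fin (suc (δ * κ)), x_j = the j-th field element),
-- columns indexed by polynomials f of degree ≤ κ; entry 1 iff f(x_j) = y.
CRow : ℕ → ℕ → ℕ → Set
CRow r κ δ = Fin (suc (δ * κ)) × Fin r

CCol : ℕ → ℕ → Set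
CCol r κ = Vec (Fin r) (suc κ)

C : ∀ r κ δ → FiniteField r → suc (δ * κ) ≤ r → CRow r κ δ → CCol r κ → Bool
C r κ δ F le (j , y) f = does (eval F f (inject≤ j le) ≟ y)

nRows : ℕ → ℕ → ℕ → ℕ
nRows r κ δ = suc (δ * κ) * r

nCols : ℕ → ℕ → ℕ
nCols r κ = r ^ suc κ

Matrix : ℕ → ℕ → Set
Matrix t n = Fin t → Fin n → Bool

IsCFF : ∀ {t n} → ℕ → Matrix t n → Set
IsCFF {t} {n} d M =
  (c : Fin n) (cs : Fin d → Fin n) → Injective _≡_ _≡_ cs → (∀ k → cs k ≢ c) →
  Σ (Fin t) λ x → M x c ≡ true × (∀ k → M x (cs k) ≡ false)

IsEmbeddingFamily : (t n d : ℕ → ℕ) → ((l : ℕ) → Matrix (t l) (n l)) → Set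
IsEmbeddingFamily t n d M =
  (∀ l → IsCFF (d l) (M l)) ×
  Σ (∀ l → t l ≤ t (suc l)) λ tle →
  Σ (∀ l → n l ≤ n (suc l)) λ nle →
  (∀ l → d l ≤ d (suc l)) ×
  (∀ l (x : Fin (t l)) (c : Fin (n l)) →
     M (suc l) (inject≤ x (tle l)) (inject≤ c (nle l)) ≡ M l x c)

-- A nested tower of fields F_{q^{2^i}} ⊆ F_{q^{2^{i+1}}}: the inclusion
-- maps the i-th field onto the first q^{2^i} elements of the next one in
-- the same order (inject≤), and is a ring homomorphism.
record FieldTower (q : ℕ) : Set where
  field
    F      : (i : ℕ) → FiniteField (q ^ (2 ^ i))
    size≤  : ∀ i → q ^ (2 ^ i) ≤ q ^ (2 ^ suc i)
    emb-+  : ∀ i (a b : Fin (q ^ (2 ^ i))) →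
               inject≤ (_+F_ (F i) a b) (size≤ i) ≡ _+F_ (F (suc i)) (inject≤ a (size≤ i)) (inject≤ b (size≤ i))
    emb-*  : ∀ i (a b : Fin (q ^ (2 ^ i))) →
               inject≤ (_*F_ (F i) a b) (size≤ i) ≡ _*F_ (F (suc i)) (inject≤ a (size≤ i)) (inject≤ b (size≤ i))
    emb-0  : ∀ i → inject≤ (0F (F i)) (size≤ i) ≡ 0F (F (suc i))
    emb-1  : ∀ i → inject≤ (1F (F i)) (size≤ i) ≡ 1F (F (suc i))

-- Two distinct polynomials of degree at most κ agree on at most κ points. Given a column f and
-- δ other columns g₁ … g_δ, at most δκ of the δκ + 1 evaluation points x_j are roots of some
-- f - gₘ, and at any other x_j the row (x_j , f(x_j)) meets f and misses every gₘ.
-- For the embedding, F_{q^{2^i}} is an initial segment of F_{q^{2^{i+1}}} closed under the field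
-- operations, so lifting a row (x_j , y) and a polynomial (padding its coefficients with zeros)
-- preserves incidences: C_i is a submatrix of C_{i+1}, and enumerating rows and columns level
-- by level, the lifted ones first, puts it in the upper-left corner.

module Submission where

open import Defs
open import Algebra.Bundles using (CommutativeRing)
import Algebra.Properties.Ring as RingProperties
open import Data.Fin as Fin using (Fin; zero; suc; inject≤; punchIn; punchOut)
open import Data.Fin.Permutation using (Permutation′; _⟨$⟩ʳ_; id; insert)
open import Data.Fin.Properties
  using (*↔×; suc-injective; 0≢1+n; punchIn-punchOut; punchOut-injective;
         inject≤-injective; inject≤-idempotent)
open import Data.Bool using (true; false)
open import Data.List using (List; []; _∷_; length; filter; allFin)
import Data.List as List
open import Data.List.Membership.Propositional using (_∈_)
open import Data.List.Membership.Propositional.Properties using (∈-filter⁻; ∈-map⁻)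
open import Data.List.Properties using (length-map; length-tabulate)
open import Data.List.Relation.Unary.All as All using (All; []; _∷_)
open import Data.List.Relation.Unary.All.Properties using (all-filter)
open import Data.List.Relation.Unary.AllPairs using ([]; _∷_)
open import Data.List.Relation.Unary.Any using (here)
open import Data.List.Relation.Unary.Unique.Propositional using (Unique)
import Data.List.Relation.Unary.Unique.Propositional.Properties as Unique
open import Data.Maybe using (nothing)
open import Data.Nat using (ℕ; zero; suc; _*_; _^_; _≤_; _<_; z≤n; s≤s; NonZero; >-nonZero)
import Data.Nat as ℕ
import Data.Nat.Properties as ℕₚ
open import Data.Product using (Σ; _×_; _,_; proj₁; proj₂; ∃-syntax)
open import Data.Product.Function.NonDependent.Propositional using (_×-↔_)
open import Data.Vec using (Vec; []; _∷_; map; replicate; padRight)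
open import Data.Vec.Properties using (∷-injective)
open import Function using (_∘_)
open import Function.Bundles using (_↔_; Inverse; mk↔ₛ′; mk⇔; Injection)
open import Function.Construct.Composition using (_↔-∘_)
open import Function.Construct.Identity using (↔-id)
open import Function.Construct.Symmetry using (↔-sym)
open import Function.Definitions using (Injective)
open import Function.Properties.Inverse using (↔⇒↣)
open import Relation.Binary.Definitions using (DecidableEquality)
open import Relation.Binary.PropositionalEquality
open import Relation.Nullary using (Dec; yes; no; does)
open import Relation.Nullary.Decidable using (dec-true; dec-false; does-⇔)
open import Relation.Unary.Properties using (∁?)
open import Tactic.RingSolver.Core.AlmostCommutativeRing using (fromCommutativeRing)

open Inverse using (to; from; strictlyInverseˡ)

length-filter+∁ : ∀ {A : Set} {P : A → Set} (P? : ∀ a → Dec (P a)) xs →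
                  length (filter P? xs) ℕ.+ length (filter (∁? P?) xs) ≡ length xs
length-filter+∁ P? [] = refl
length-filter+∁ P? (x ∷ xs) with P? x
... | yes _ = cong suc (length-filter+∁ P? xs)
... | no  _ = trans (ℕₚ.+-suc _ _) (cong suc (length-filter+∁ P? xs))

padRight-injective : ∀ {A : Set} {m n} (m≤n : m ≤ n) (a : A) → Injective _≡_ _≡_ (padRight m≤n a)
padRight-injective z≤n       a {[]}     {[]}     _  = refl
padRight-injective (s≤s m≤n) a {x ∷ xs} {y ∷ ys} eq =
  cong₂ _∷_ (proj₁ (∷-injective eq)) (padRight-injective m≤n a (proj₂ (∷-injective eq)))

map-injective : ∀ {A B : Set} {f : A → B} → Injective _≡_ _≡_ f →
                ∀ {n} → Injective _≡_ _≡_ (map {n = n} f)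
map-injective f-inj {x = []}     {[]}     _  = refl
map-injective f-inj {x = x ∷ xs} {y ∷ ys} eq =
  cong₂ _∷_ (f-inj (proj₁ (∷-injective eq))) (map-injective f-inj (proj₂ (∷-injective eq)))

↔-injective : ∀ {A B : Set} (σ : A ↔ B) → Injective _≡_ _≡_ (to σ)
↔-injective σ = Injection.injective (↔⇒↣ σ)

^↔Vec : ∀ r n → Fin (r ^ n) ↔ Vec (Fin r) n
^↔Vec r zero    = mk↔ₛ′ (λ _ → []) (λ _ → zero) (λ { [] → refl }) (λ { zero → refl })
^↔Vec r (suc n) = cons ↔-∘ ((↔-id _ ×-↔ ^↔Vec r n) ↔-∘ *↔×)
  where
  cons : ∀ {A : Set} {n} → (A × Vec A n) ↔ Vec A (suc n)
  cons = mk↔ₛ′ (λ (x , xs) → x ∷ xs) (λ { (x ∷ xs) → x , xs })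
               (λ { (x ∷ xs) → refl }) (λ { (x , xs) → refl })

extendPermutation : ∀ {n m} (n≤m : n ≤ m) (g : Fin n → Fin m) → Injective _≡_ _≡_ g →
                    Σ (Permutation′ m) λ π → ∀ x → π ⟨$⟩ʳ inject≤ x n≤m ≡ g x
extendPermutation z≤n       g g-inj = id , λ ()
extendPermutation (s≤s n≤m) g g-inj = insert zero (g zero) π , extends
  where
  g0≢g : ∀ x → g zero ≢ g (suc x)
  g0≢g x eq = 0≢1+n (g-inj eq)
  g′ : Fin _ → Fin _
  g′ x = punchOut (g0≢g x)
  g′-inj : Injective _≡_ _≡_ g′
  g′-inj {x} {y} eq = suc-injective (g-inj (punchOut-injective (g0≢g x) (g0≢g y) eq))
  π = proj₁ (extendPermutation n≤m g′ g′-inj)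
  extends : ∀ x → insert zero (g zero) π ⟨$⟩ʳ inject≤ x (s≤s n≤m) ≡ g x
  extends zero    = refl
  extends (suc x) = trans (cong (punchIn (g zero)) (proj₂ (extendPermutation n≤m g′ g′-inj) x))
                          (punchIn-punchOut (g0≢g x))

extendBijection : ∀ {A B : Set} {n m} (n≤m : n ≤ m) (σ : Fin n ↔ A) (β : Fin m ↔ B)
                  (e : A → B) → Injective _≡_ _≡_ e →
                  Σ (Fin m ↔ B) λ ρ → ∀ x → to ρ (inject≤ x n≤m) ≡ e (to σ x)
extendBijection n≤m σ β e e-inj = β ↔-∘ π , λ x → trans (cong (to β) (extends x)) (strictlyInverseˡ β _)
  where
  g = from β ∘ e ∘ to σ
  g-inj : Injective _≡_ _≡_ g
  g-inj = ↔-injective σ ∘ e-inj ∘ ↔-injective (↔-sym β)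
  π = proj₁ (extendPermutation n≤m g g-inj)
  extends = proj₂ (extendPermutation n≤m g g-inj)

compatibleBijections : ∀ (t : ℕ → ℕ) (X : ℕ → Set) → (∀ i → Fin (t i) ↔ X i) →
  (t≤ : ∀ i → t i ≤ t (suc i)) (e : ∀ i → X i → X (suc i)) → (∀ i → Injective _≡_ _≡_ (e i)) →
  Σ (∀ i → Fin (t i) ↔ X i) λ σ → ∀ i x → to (σ (suc i)) (inject≤ x (t≤ i)) ≡ e i (to (σ i) x)
compatibleBijections t X β t≤ e e-inj = σ , λ i → proj₂ (step i)
  where
  σ : ∀ i → Fin (t i) ↔ X i
  step : ∀ i → Σ (Fin (t (suc i)) ↔ X (suc i)) λ ρ → ∀ x → to ρ (inject≤ x (t≤ i)) ≡ e i (to (σ i) x)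
  σ zero    = β zero
  σ (suc i) = proj₁ (step i)
  step i = extendBijection (t≤ i) (σ i) (β (suc i)) (e i) (e-inj i)

module FieldPolynomials {A : Set} (F : FieldOn A) where

  commutativeRing : CommutativeRing _ _
  commutativeRing = record { isCommutativeRing = isCommutativeRing F }

  open CommutativeRing commutativeRing
    using (_+_; _-_; 0#; 1#; +-identityˡ; *-assoc; *-comm; *-identityˡ; zeroʳ; ring)
    renaming (_*_ to _·_)
  open RingProperties ring using (+-cancelˡ; +-cancelʳ; //-rightDividesˡ; x∙y⁻¹≈ε⇒x≈y)
  open import Tactic.RingSolver.NonReflective (fromCommutativeRing commutativeRing (λ _ → nothing))
    using (solve; _⊜_; _⊕_; _⊗_)
  open ≡-Reasoning

  ev : ∀ {n} → Vec A n → A → A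
  ev = eval F

  *-cancelˡ-≢0 : ∀ {c u v} → c ≢ 0# → c · u ≡ c · v → u ≡ v
  *-cancelˡ-≢0 {c} {u} {v} c≢0 cu≡cv = begin
    u               ≡⟨ cancel u ⟩
    c⁻¹ · (c · u)   ≡⟨ cong (c⁻¹ ·_) cu≡cv ⟩
    c⁻¹ · (c · v)   ≡⟨ cancel v ⟨
    v               ∎
    where
    c⁻¹ = _⁻¹ F c
    cancel : ∀ w → w ≡ c⁻¹ · (c · w)
    cancel w = begin
      w               ≡⟨ *-identityˡ w ⟨
      1# · w          ≡⟨ cong (_· w) (trans (sym (inverse F c c≢0)) (*-comm c c⁻¹)) ⟩
      (c⁻¹ · c) · w   ≡⟨ *-assoc c⁻¹ c w ⟩
      c⁻¹ · (c · w)   ∎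

  -- The two hypotheses say (a - b) u = z - y = (a - b) v.
  linear-cancel : ∀ {a b y z u v} → a ≢ b →
                  y + a · u ≡ z + b · u → y + a · v ≡ z + b · v → u ≡ v
  linear-cancel {a} {b} {y} {z} {u} {v} a≢b eqᵤ eqᵥ =
    *-cancelˡ-≢0 (λ c≡0 → a≢b (x∙y⁻¹≈ε⇒x≈y a b c≡0))
      (+-cancelˡ y _ _ (trans (solved u eqᵤ) (sym (solved v eqᵥ))))
    where
    c = a - b
    solved : ∀ w → y + a · w ≡ z + b · w → y + c · w ≡ z
    solved w eq = +-cancelʳ (b · w) _ _ (begin
      (y + c · w) + b · w   ≡⟨ solve 4 (λ y c b w → ((y ⊕ c ⊗ w) ⊕ b ⊗ w) ⊜ (y ⊕ (c ⊕ b) ⊗ w)) refl y c b w ⟩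
      y + (c + b) · w       ≡⟨ cong (λ t → y + t · w) (//-rightDividesˡ b a) ⟩
      y + a · w             ≡⟨ eq ⟩
      z + b · w             ∎)

  -- The quotient of p by x - a (synthetic division); eval-divLinear says
  -- p(x) - p(a) = (x - a) · q(x) with the subtractions moved across.
  divLinear : ∀ {n} → A → Vec A (suc n) → Vec A n
  divLinear {zero}  a (c ∷ [])  = []
  divLinear {suc n} a (c ∷ cs) = ev cs a ∷ divLinear a cs

  eval-divLinear : ∀ {n} a (p : Vec A (suc n)) x →
                   ev p x + a · ev (divLinear a p) x ≡ ev p a + x · ev (divLinear a p) x
  eval-divLinear {zero} a (c ∷ []) x =
    solve 4 (λ c x a o → ((c ⊕ x ⊗ o) ⊕ a ⊗ o) ⊜ ((c ⊕ a ⊗ o) ⊕ x ⊗ o)) refl c x a 0#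
  eval-divLinear {suc n} a (c ∷ cs) x = begin
    (c + x · P) + a · (Pa + x · H)   ≡⟨ solve 6 (λ c x a P Pa H →
                                          ((c ⊕ x ⊗ P) ⊕ a ⊗ (Pa ⊕ x ⊗ H)) ⊜ ((c ⊕ a ⊗ Pa) ⊕ x ⊗ (P ⊕ a ⊗ H)))
                                        refl c x a P Pa H ⟩
    (c + a · Pa) + x · (P + a · H)   ≡⟨ cong (λ t → (c + a · Pa) + x · t) (eval-divLinear a cs x) ⟩
    (c + a · Pa) + x · (Pa + x · H)  ∎
    where
    P = ev cs x
    Pa = ev cs a
    H = ev (divLinear a cs) x

  divLinear-injective : ∀ {n} a (f g : Vec A (suc n)) →
                        divLinear a f ≡ divLinear a g → ev f a ≡ ev g a → f ≡ g
  divLinear-injective {zero} a (c ∷ []) (d ∷ []) _ fa≡ga =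
    cong (_∷ []) (+-cancelʳ (a · 0#) c d fa≡ga)
  divLinear-injective {suc n} a (c ∷ f) (d ∷ g) qf≡qg fa≡ga
    with fa′≡ga′ , qf′≡qg′ ← ∷-injective qf≡qg
    with refl ← divLinear-injective a f g qf′≡qg′ fa′≡ga′ =
    cong (_∷ f) (+-cancelʳ (a · ev f a) c d fa≡ga)

  agree⇒≡ : ∀ {n} (f g : Vec A n) (xs : List A) → Unique xs → n ≤ length xs →
            All (λ a → ev f a ≡ ev g a) xs → f ≡ g
  agree⇒≡ [] [] _ _ _ _ = refl
  agree⇒≡ f@(_ ∷ _) g@(_ ∷ _) (a ∷ xs) (a∉xs ∷ xs!) (s≤s n≤len) (fa≡ga ∷ f≗g) =
    divLinear-injective a f g
      (agree⇒≡ (divLinear a f) (divLinear a g) xs xs! n≤len (All.zipWith quotients-agree (a∉xs , f≗g)))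
      fa≡ga
    where
    quotients-agree : ∀ {b} → a ≢ b × ev f b ≡ ev g b → ev (divLinear a f) b ≡ ev (divLinear a g) b
    quotients-agree {b} (a≢b , fb≡gb) = linear-cancel a≢b (eval-divLinear a f b) (begin
      ev f b + a · ev (divLinear a g) b   ≡⟨ cong (_+ a · ev (divLinear a g) b) fb≡gb ⟩
      ev g b + a · ev (divLinear a g) b   ≡⟨ eval-divLinear a g b ⟩
      ev g a + b · ev (divLinear a g) b   ≡⟨ cong (_+ b · ev (divLinear a g) b) fa≡ga ⟨
      ev f a + b · ev (divLinear a g) b   ∎)

  agreeing-points≤ : ∀ {k} (f g : Vec A (suc k)) → f ≢ g → (xs : List A) → Unique xs →
                     All (λ a → ev f a ≡ ev g a) xs → length xs ≤ k
  agreeing-points≤ f g f≢g xs xs! f≗g = ℕₚ.≮⇒≥ (λ k<len → f≢g (agree⇒≡ f g xs xs! k<len f≗g))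

  padRight-zeros : ∀ {m n} (m≤n : m ≤ n) (f : Vec A m) x → ev (padRight m≤n 0# f) x ≡ ev f x
  padRight-zeros {n = n} z≤n [] x = eval-replicate n
    where
    eval-replicate : ∀ n → ev (replicate n 0#) x ≡ 0#
    eval-replicate zero    = refl
    eval-replicate (suc n) = trans (cong (λ t → 0# + x · t) (eval-replicate n))
                                   (trans (cong (0# +_) (zeroʳ x)) (+-identityˡ 0#))
  padRight-zeros (s≤s m≤n) (c ∷ f) x = cong (λ t → c + x · t) (padRight-zeros m≤n f x)

module SeparatingPoint {A : Set} (F : FieldOn A) (_≟_ : DecidableEquality A) where

  open FieldPolynomials F using (ev; agreeing-points≤)

  -- Each gₘ agrees with f on at most k points, so d k agreements cannot exhaust the list.
  separatingPoint : ∀ {k} d (f : Vec A (suc k)) (gs : Fin d → Vec A (suc k)) → (∀ m → f ≢ gs m) →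
                    (xs : List A) → Unique xs → d * k < length xs →
                    ∃[ a ] a ∈ xs × (∀ m → ev f a ≢ ev (gs m) a)
  separatingPoint zero f gs f≢gs (a ∷ xs) _ _ = a , here refl , λ ()
  separatingPoint {k} (suc d) f gs f≢gs xs xs! len =
    separates-from-g₀ (separatingPoint d f (gs ∘ suc) (f≢gs ∘ suc) rest
                         (Unique.filter⁺ (∁? agrees?) xs!) rest-long)
    where
    agrees? : ∀ a → Dec (ev f a ≡ ev (gs zero) a)
    agrees? a = ev f a ≟ ev (gs zero) a
    rest = filter (∁? agrees?) xs
    few-agree : length (filter agrees? xs) ≤ k
    few-agree = agreeing-points≤ f (gs zero) (f≢gs zero) (filter agrees? xs)
                  (Unique.filter⁺ agrees? xs!) (all-filter agrees? xs)
    rest-long : d * k < length rest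
    rest-long = ℕₚ.+-cancelˡ-< k _ _ (begin-strict
      k ℕ.+ d * k                                  <⟨ len ⟩
      length xs                                    ≡⟨ length-filter+∁ agrees? xs ⟨
      length (filter agrees? xs) ℕ.+ length rest   ≤⟨ ℕₚ.+-monoˡ-≤ (length rest) few-agree ⟩
      k ℕ.+ length rest                            ∎)
      where open ℕₚ.≤-Reasoning
    separates-from-g₀ : ∃[ a ] a ∈ rest × (∀ m → ev f a ≢ ev (gs (suc m)) a) →
                        ∃[ a ] a ∈ xs × (∀ m → ev f a ≢ ev (gs m) a)
    separates-from-g₀ (a , a∈rest , separates) =
      let a∈xs , disagrees = ∈-filter⁻ (∁? agrees?) a∈rest
      in a , a∈xs , λ { zero → disagrees ; (suc m) → separates m }

eval-map : ∀ {A B : Set} (F : FieldOn A) (G : FieldOn B) (φ : A → B) →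
           (∀ a b → φ (_+F_ F a b) ≡ _+F_ G (φ a) (φ b)) →
           (∀ a b → φ (_*F_ F a b) ≡ _*F_ G (φ a) (φ b)) →
           φ (0F F) ≡ 0F G →
           ∀ {n} (f : Vec A n) a → eval G (map φ f) (φ a) ≡ φ (eval F f a)
eval-map F G φ φ-+ φ-* φ-0 []      a = sym φ-0
eval-map F G φ φ-+ φ-* φ-0 (c ∷ f) a = begin
  φ c +ᴳ (φ a *ᴳ eval G (map φ f) (φ a))   ≡⟨ cong (λ t → φ c +ᴳ (φ a *ᴳ t)) (eval-map F G φ φ-+ φ-* φ-0 f a) ⟩
  φ c +ᴳ (φ a *ᴳ φ (eval F f a))           ≡⟨ cong (φ c +ᴳ_) (φ-* a _) ⟨
  φ c +ᴳ φ (a *ᶠ eval F f a)               ≡⟨ φ-+ c _ ⟨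
  φ (c +ᶠ (a *ᶠ eval F f a))               ∎
  where
  open ≡-Reasoning
  open FieldOn F using () renaming (_+F_ to _+ᶠ_; _*F_ to _*ᶠ_)
  open FieldOn G using () renaming (_+F_ to _+ᴳ_; _*F_ to _*ᴳ_)

C-separatingRow : ∀ r κ δ (F : FiniteField r) (le : suc (δ * κ) ≤ r)
                  (f : CCol r κ) (gs : Fin δ → CCol r κ) → (∀ m → f ≢ gs m) →
                  Σ (CRow r κ δ) λ w → C r κ δ F le w f ≡ true × (∀ m → C r κ δ F le w (gs m) ≡ false)
C-separatingRow r κ δ F le f gs f≢gs =
  row (SeparatingPoint.separatingPoint F Fin._≟_ δ f gs f≢gs pts pts! pts-long)
  where
  pt : Fin (suc (δ * κ)) → Fin r
  pt j = inject≤ j le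
  pts = List.map pt (allFin (suc (δ * κ)))
  pts! : Unique pts
  pts! = Unique.map⁺ (inject≤-injective le le _ _) (Unique.allFin⁺ _)
  pts-long : δ * κ < length pts
  pts-long = ℕₚ.≤-reflexive (sym (trans (length-map pt (allFin _)) (length-tabulate (λ j → j))))
  row : ∃[ a ] a ∈ pts × (∀ m → eval F f a ≢ eval F (gs m) a) →
        Σ (CRow r κ δ) λ w → C r κ δ F le w f ≡ true × (∀ m → C r κ δ F le w (gs m) ≡ false)
  row (a , a∈pts , separates) with j , _ , refl ← ∈-map⁻ pt a∈pts =
    (j , eval F f (pt j)) ,
    dec-true (eval F f (pt j) Fin.≟ eval F f (pt j)) refl ,
    λ m → dec-false (_ Fin.≟ _) (separates m ∘ sym)

C-isCFF : ∀ r κ δ (F : FiniteField r) (le : suc (δ * κ) ≤ r)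
          (σ : Fin (nRows r κ δ) ↔ CRow r κ δ) (τ : Fin (nCols r κ) ↔ CCol r κ) →
          IsCFF δ (λ x c → C r κ δ F le (to σ x) (to τ c))
C-isCFF r κ δ F le σ τ c cs _ cs≢c =
  let w , hit , misses = C-separatingRow r κ δ F le (to τ c) (to τ ∘ cs)
                           (λ m eq → cs≢c m (↔-injective τ (sym eq)))
      relabel : ∀ f {b} → C r κ δ F le w f ≡ b → C r κ δ F le (to σ (from σ w)) f ≡ b
      relabel f = subst (λ v → C r κ δ F le v f ≡ _) (sym (strictlyInverseˡ σ w))
  in from σ w , relabel (to τ c) hit , λ m → relabel (to τ (cs m)) (misses m)

nRows-mono : ∀ {r r′ κ κ′ δ δ′} → κ ≤ κ′ → δ ≤ δ′ → r ≤ r′ → nRows r κ δ ≤ nRows r′ κ′ δ′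
nRows-mono κ≤κ′ δ≤δ′ r≤r′ = ℕₚ.*-mono-≤ (s≤s (ℕₚ.*-mono-≤ δ≤δ′ κ≤κ′)) r≤r′

nCols-mono : ∀ {r r′ κ κ′} → .{{NonZero r′}} → κ ≤ κ′ → r ≤ r′ → nCols r κ ≤ nCols r′ κ′
nCols-mono {r′ = r′} {κ} κ≤κ′ r≤r′ = ℕₚ.≤-trans (ℕₚ.^-monoˡ-≤ (suc κ) r≤r′) (ℕₚ.^-monoʳ-≤ r′ (s≤s κ≤κ′))

module FieldExtension {r r′} (F : FiniteField r) (F′ : FiniteField r′) (r≤r′ : r ≤ r′)
  (ι-+ : ∀ a b → inject≤ (_+F_ F a b) r≤r′ ≡ _+F_ F′ (inject≤ a r≤r′) (inject≤ b r≤r′))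
  (ι-* : ∀ a b → inject≤ (_*F_ F a b) r≤r′ ≡ _*F_ F′ (inject≤ a r≤r′) (inject≤ b r≤r′))
  (ι-0 : inject≤ (0F F) r≤r′ ≡ 0F F′)
  where

  ι : Fin r → Fin r′
  ι a = inject≤ a r≤r′

  ι-injective : Injective _≡_ _≡_ ι
  ι-injective = inject≤-injective r≤r′ r≤r′ _ _

  does-ι≟ι : ∀ a b → does (ι a Fin.≟ ι b) ≡ does (a Fin.≟ b)
  does-ι≟ι a b = does-⇔ (mk⇔ ι-injective (cong ι)) (ι a Fin.≟ ι b) (a Fin.≟ b)

  liftPoly : ∀ {κ κ′} → κ ≤ κ′ → CCol r κ → CCol r′ κ′
  liftPoly κ≤κ′ f = padRight (s≤s κ≤κ′) (0F F′) (map ι f)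

  liftPoly-injective : ∀ {κ κ′} (κ≤κ′ : κ ≤ κ′) → Injective _≡_ _≡_ (liftPoly κ≤κ′)
  liftPoly-injective κ≤κ′ = map-injective ι-injective ∘ padRight-injective (s≤s κ≤κ′) (0F F′)

  liftRow : ∀ {m m′} → m ≤ m′ → Fin (suc m) × Fin r → Fin (suc m′) × Fin r′
  liftRow m≤m′ (j , y) = inject≤ j (s≤s m≤m′) , ι y

  liftRow-injective : ∀ {m m′} (m≤m′ : m ≤ m′) → Injective _≡_ _≡_ (liftRow m≤m′)
  liftRow-injective m≤m′ {j , y} {j′ , y′} eq =
    cong₂ _,_ (inject≤-injective _ _ j j′ (cong proj₁ eq)) (ι-injective (cong proj₂ eq))

  C-lift : ∀ {κ δ κ′ δ′} (κ≤κ′ : κ ≤ κ′) (δ≤δ′ : δ ≤ δ′)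
           (le : suc (δ * κ) ≤ r) (le′ : suc (δ′ * κ′) ≤ r′) w f →
           C r′ κ′ δ′ F′ le′ (liftRow (ℕₚ.*-mono-≤ δ≤δ′ κ≤κ′) w) (liftPoly κ≤κ′ f) ≡ C r κ δ F le w f
  C-lift κ≤κ′ δ≤δ′ le le′ (j , y) f =
    trans (cong (λ v → does (v Fin.≟ ι y)) eval-lift) (does-ι≟ι (eval F f x) y)
    where
    open ≡-Reasoning
    x = inject≤ j le
    j≤r′ = ℕₚ.≤-trans le r≤r′
    eval-lift : eval F′ (liftPoly κ≤κ′ f) (inject≤ (inject≤ j (s≤s (ℕₚ.*-mono-≤ δ≤δ′ κ≤κ′))) le′)
                ≡ ι (eval F f x)
    eval-lift = begin
      eval F′ (liftPoly κ≤κ′ f) (inject≤ (inject≤ j (s≤s (ℕₚ.*-mono-≤ δ≤δ′ κ≤κ′))) le′)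
        ≡⟨ cong (eval F′ (liftPoly κ≤κ′ f))
                (trans (inject≤-idempotent j _ _ j≤r′) (sym (inject≤-idempotent j le r≤r′ j≤r′))) ⟩
      eval F′ (liftPoly κ≤κ′ f) (ι x)   ≡⟨ FieldPolynomials.padRight-zeros F′ (s≤s κ≤κ′) (map ι f) (ι x) ⟩
      eval F′ (map ι f) (ι x)            ≡⟨ eval-map F F′ ι ι-+ ι-* ι-0 f x ⟩
      ι (eval F f x)                     ∎

theorem4 : (q : ℕ) → IsPrimePower q → (T : FieldTower q) →
  (k d : ℕ → ℕ) → (∀ i → 0 < k i) → (∀ i → 0 < d i) →
  (h0 : suc (d 0 * k 0) ≤ q) →
  (∀ i → k i ≤ k (suc i)) → (∀ i → d i ≤ d (suc i)) →
  (hs : ∀ i → suc (d (suc i) * k (suc i)) ≤ q ^ (2 ^ i)) →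
  (le : ∀ i → suc (d i * k i) ≤ q ^ (2 ^ i)) →
  Σ (∀ i → Fin (nRows (q ^ (2 ^ i)) (k i) (d i)) ↔ CRow (q ^ (2 ^ i)) (k i) (d i)) λ σ →
  Σ (∀ i → Fin (nCols (q ^ (2 ^ i)) (k i)) ↔ CCol (q ^ (2 ^ i)) (k i)) λ τ →
    IsEmbeddingFamily
      (λ i → nRows (q ^ (2 ^ i)) (k i) (d i))
      (λ i → nCols (q ^ (2 ^ i)) (k i))
      d
      (λ i x c → C (q ^ (2 ^ i)) (k i) (d i) (FieldTower.F T i) (le i)
                   (Inverse.to (σ i) x) (Inverse.to (τ i) c))
theorem4 q _ T k d _ _ _ k≤ d≤ _ le =
  σ , τ , (λ i → C-isCFF (r i) (k i) (d i) (F i) (le i) (σ i) (τ i)) , rows≤ , cols≤ , d≤ ,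
  λ i x c → trans (cong₂ (C (r (suc i)) (k (suc i)) (d (suc i)) (F (suc i)) (le (suc i)))
                         (σ-lifts i x) (τ-lifts i c))
                  (Step.C-lift i (k≤ i) (d≤ i) (le i) (le (suc i)) (to (σ i) x) (to (τ i) c))
  where
  open FieldTower T
  module Step i = FieldExtension (F i) (F (suc i)) (size≤ i) (emb-+ i) (emb-* i) (emb-0 i)
  r : ℕ → ℕ
  r i = q ^ (2 ^ i)
  rows≤ : ∀ i → nRows (r i) (k i) (d i) ≤ nRows (r (suc i)) (k (suc i)) (d (suc i))
  rows≤ i = nRows-mono (k≤ i) (d≤ i) (size≤ i)
  cols≤ : ∀ i → nCols (r i) (k i) ≤ nCols (r (suc i)) (k (suc i))
  cols≤ i = nCols-mono {{>-nonZero (ℕₚ.<-≤-trans (s≤s z≤n) (le (suc i)))}} (k≤ i) (size≤ i)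
  δκ≤ : ∀ i → d i * k i ≤ d (suc i) * k (suc i)
  δκ≤ i = ℕₚ.*-mono-≤ (d≤ i) (k≤ i)
  rows = compatibleBijections _ _ (λ i → *↔×) rows≤
           (λ i → Step.liftRow i (δκ≤ i)) (λ i → Step.liftRow-injective i (δκ≤ i))
  cols = compatibleBijections _ _ (λ i → ^↔Vec (r i) (suc (k i))) cols≤
           (λ i → Step.liftPoly i (k≤ i)) (λ i → Step.liftPoly-injective i (k≤ i))
  σ : ∀ i → Fin (nRows (r i) (k i) (d i)) ↔ CRow (r i) (k i) (d i)
  σ = proj₁ rows
  σ-lifts = proj₂ rows
  τ : ∀ i → Fin (nCols (r i) (k i)) ↔ CCol (r i) (k i)
  τ = proj₁ cols
  τ-lifts = proj₂ cols
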